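{- Let $a$ be a positive integer that is not a perfect cube and let $b>1$ be an integer. Then there are only finitely many Fermat pseudoprimes to the base $b$ of the form $ap^3+1$, where $p$ ranges over the primes.
   Context: For a positive integer $b$, a Fermat pseudoprime to the base $b$ is a composite positive integer $n$ such that $b^{n-1}\equiv 1 \pmod n$. -}

module Defs where

open import Data.Nat using (ℕ; _^_; _∸_; _*_; _+_)
open import Data.Nat.Divisibility using (_∣_)
open import Data.Nat.Primality using (Composite)
open import Data.Product using (_×_; ∃)
open import Relation.Binary.PropositionalEquality using (_≡_)

IsPerfectCube : ℕ → Set
IsPerfectCube a = ∃ λ c → a ≡ c ^ 3

-- n is a Fermat pseudoprime to base b: n composite and b^(n-1) ≡ 1 (mod n),
-- expressed as n ∣ b^(n-1) - 1 (truncated subtraction is exact since b ≥ 1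
-- in all uses, so b^(n-1) ≥ 1).
FermatPseudoprime : ℕ → ℕ → Set
FermatPseudoprime b n = Composite n × (n ∣ b ^ (n ∸ 1) ∸ 1)

{-# OPTIONS --safe #-}
-- Suppose n = a p³ + 1 is a pseudoprime to base b with p > 4a² + b^a.  A prime factor r ≡ 1 (mod p)
-- of n would give n = (1 + x p)(1 + y p), i.e. x + y + x y p = a p²; writing x + y = s p and
-- comparing x s with a, this forces a = x³ or p ≤ 4a².  So p ∤ r - 1 for every prime r ∣ n, and the
-- order of b modulo r, dividing both a p³ and r - 1, divides a: every prime factor of n divides
-- b^a - 1.  As b^(a p³) - 1 = (b^a - 1) S with S ≡ p³ (mod b^a - 1) and p ∤ n, n is coprime to S,
-- so n divides b^a - 1 < p < n, which is absurd.
module Submission where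

open import Defs
open import Data.Nat using (ℕ; _^_; _*_; _+_; _≤_; _<_)
open import Data.Nat.Primality using (Prime)
open import Data.Product using (∃)
open import Relation.Nullary using (¬_)

open import Data.Nat.Base
open import Data.Nat.Properties
open import Data.Nat.Divisibility
open import Data.Nat.Primality
open import Data.Nat.Primality.Factorisation using (factorise)
open import Data.Nat.Coprimality using (Coprime; coprime-divisor)
open import Data.Nat.GCD using (gcd; gcd-GCD; gcd[m,n]∣m; gcd[m,n]∣n; module Bézout)
open import Data.Nat.Combinatorics using (_C_; nCk≡n!/k![n-k]!; k![n∸k]!∣n!; nCn≡1)
open import Data.Nat.DivMod using (m/n*n≡m)
open import Data.Nat.Tactic.RingSolver using (solve-∀)
open import Data.Fin.Base using (zero; suc; toℕ; inject₁; fromℕ)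
open import Data.Fin.Properties using (toℕ-inject₁; toℕ-fromℕ; toℕ<n)
open import Data.List.Base using (_∷_)
open import Data.List.Relation.Unary.All using (_∷_)
open import Data.Nat.ListAction using (product)
open import Data.Vec.Functional using (Vector; init; last; tail)
open import Data.Product using (∃₂; _×_; _,_; proj₁; proj₂)
open import Data.Sum using (_⊎_; inj₁; inj₂; [_,_]′)
open import Data.Empty using (⊥; ⊥-elim)
open import Relation.Nullary using (contradiction)
open import Relation.Binary.PropositionalEquality
open import Relation.Binary.Definitions using (tri<; tri≈; tri>)
open import Algebra.Definitions.RawSemiring +-*-rawSemiring
  using () renaming (_^_ to _^ᴿ_; _×_ to _×ᴿ_)
import Algebra.Properties.CommutativeSemiring.Binomial +-*-commutativeSemiring as Binomial
import Algebra.Properties.Monoid.Sum +-0-monoid as Sum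

×ᴿ≡* : ∀ m x → m ×ᴿ x ≡ m * x
×ᴿ≡* zero    x = refl
×ᴿ≡* (suc m) x = cong (x +_) (×ᴿ≡* m x)

^ᴿ≡^ : ∀ x m → x ^ᴿ m ≡ x ^ m
^ᴿ≡^ x zero    = refl
^ᴿ≡^ x (suc m) = cong (x *_) (^ᴿ≡^ x m)

∣-sum : ∀ {d n} (f : Vector ℕ n) → (∀ i → d ∣ f i) → d ∣ Sum.sum f
∣-sum {n = zero}  f _   = _ ∣0
∣-sum {n = suc n} f d∣f = ∣m∣n⇒∣m+n (d∣f zero) (∣-sum (tail f) (λ i → d∣f (suc i)))

prime∣^⇒∣ : ∀ {p m} → Prime p → ∀ k → p ∣ m ^ k → p ∣ m
prime∣^⇒∣ pp zero    p∣1 = contradiction (subst Prime (∣1⇒≡1 p∣1) pp) ¬prime[1]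
prime∣^⇒∣ {m = m} pp (suc k) p∣m^k+1 with euclidsLemma m (m ^ k) pp p∣m^k+1
... | inj₁ p∣m   = p∣m
... | inj₂ p∣m^k = prime∣^⇒∣ pp k p∣m^k

prime∤! : ∀ {p} → Prime p → ∀ {m} → m < p → ¬ p ∣ m !
prime∤! pp {zero}  _   p∣1  = ¬prime[1] (subst Prime (∣1⇒≡1 p∣1) pp)
prime∤! pp {suc m} m<p p∣m! with euclidsLemma (suc m) (m !) pp p∣m!
... | inj₁ p∣m   = <⇒≱ m<p (∣⇒≤ p∣m)
... | inj₂ p∣m!′ = prime∤! pp (<-trans (n<1+n m) m<p) p∣m!′

-- p C k * k! * (p - k)! = p!, and p divides p! but neither of the other factorials.
prime∣C : ∀ {p k} → Prime p → 0 < k → k < p → p ∣ p C k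
prime∣C {p@(suc n)} {k} pp 0<k k<p
  with euclidsLemma (p C k) (k ! * (p ∸ k) !) pp p∣p!
  where
  instance _ = k !* (p ∸ k) !≢0
  p∣p! : p ∣ (p C k) * (k ! * (p ∸ k) !)
  p∣p! = subst (p ∣_) (sym (trans (cong (_* (k ! * (p ∸ k) !)) (nCk≡n!/k![n-k]! (<⇒≤ k<p)))
                                  (m/n*n≡m (k![n∸k]!∣n! (<⇒≤ k<p)))))
               (m∣m*n (n !))
... | inj₁ p∣C    = p∣C
... | inj₂ p∣k!*[p∸k]! with euclidsLemma (k !) ((p ∸ k) !) pp p∣k!*[p∸k]!
...   | inj₁ p∣k!      = contradiction p∣k! (prime∤! pp k<p)
...   | inj₂ p∣[p∸k]! = contradiction p∣[p∸k]! (prime∤! pp (∸-monoʳ-< 0<k (<⇒≤ k<p)))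

freshman's-dream : ∀ {p} → Prime p → ∀ x → ∃ λ t → suc x ^ p ≡ x ^ p + (t * p + 1)
freshman's-dream {p@(suc n)} pp x = quotient p∣middle , (begin
  suc x ^ p                               ≡⟨ ^ᴿ≡^ (1 + x) p ⟨
  (1 + x) ^ᴿ p                            ≡⟨ Binomial.theorem p 1 x ⟩
  term zero + Sum.sum (tail term)         ≡⟨ cong (term zero +_) (Sum.sum-init-last (tail term)) ⟩
  term zero + (middle + last (tail term)) ≡⟨ cong₂ (λ u v → u + (middle + v)) first-term last-term ⟩
  x ^ p + (middle + 1)                    ≡⟨ cong (λ m → x ^ p + (m + 1)) (m∣n⇒n≡quotient*m p∣middle) ⟩
  x ^ p + (quotient p∣middle * p + 1)     ∎)
  where
  open ≡-Reasoning
  term : Vector ℕ (suc p)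
  term = Binomial.binomialTerm 1 x p
  middle : ℕ
  middle = Sum.sum (init (tail term))
  p∣middle : p ∣ middle
  p∣middle = ∣-sum (init (tail term)) λ i →
    let k = toℕ (inject₁ i) in
    subst (p ∣_) (sym (×ᴿ≡* (p C suc k) (Binomial.binomial 1 x p (suc (inject₁ i)))))
      (∣m⇒∣m*n _ (prime∣C pp (s≤s z≤n) (s≤s (subst (_< n) (sym (toℕ-inject₁ i)) (toℕ<n i)))))
  first-term : term zero ≡ x ^ p
  first-term = begin
    1 ×ᴿ (1 * x ^ᴿ p)  ≡⟨ ×ᴿ≡* 1 _ ⟩
    1 * (1 * x ^ᴿ p)   ≡⟨ trans (*-identityˡ _) (trans (*-identityˡ _) (^ᴿ≡^ x p)) ⟩
    x ^ p              ∎
  last-term : term (suc (fromℕ n)) ≡ 1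
  last-term = begin
    (p C suc k) ×ᴿ (1 ^ᴿ suc k * x ^ᴿ (n ∸ k))
      ≡⟨ cong (λ j → (p C suc j) ×ᴿ (1 ^ᴿ suc j * x ^ᴿ (n ∸ j))) (toℕ-fromℕ n) ⟩
    (p C p) ×ᴿ (1 ^ᴿ p * x ^ᴿ (n ∸ n))
      ≡⟨ cong₂ (λ c e → c ×ᴿ (1 ^ᴿ p * x ^ᴿ e)) (nCn≡1 p) (n∸n≡0 n) ⟩
    1 ×ᴿ (1 ^ᴿ p * 1)
      ≡⟨ trans (×ᴿ≡* 1 _) (trans (*-identityˡ _) (trans (*-identityʳ _) (^ᴿ≡^ 1 p))) ⟩
    1 ^ p
      ≡⟨ ^-zeroˡ p ⟩
    1 ∎
    where k = toℕ (fromℕ n)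

fermat-little : ∀ {p} → Prime p → ∀ x → ∃ λ t → x ^ p ≡ x + t * p
fermat-little {suc n} pp zero    = 0 , refl
fermat-little {p}     pp (suc x) with fermat-little pp x | freshman's-dream pp x
... | s , x^p≡ | t , suc[x]^p≡ = s + t , (begin
  suc x ^ p                  ≡⟨ suc[x]^p≡ ⟩
  x ^ p + (t * p + 1)        ≡⟨ cong (_+ (t * p + 1)) x^p≡ ⟩
  x + s * p + (t * p + 1)    ≡⟨ regroup x s t p ⟩
  suc x + (s + t) * p        ∎)
  where
  open ≡-Reasoning
  regroup : ∀ x s t p → x + s * p + (t * p + 1) ≡ suc x + (s + t) * p
  regroup = solve-∀

fermat-little′ : ∀ {p} → Prime p → ∀ {x} → ¬ p ∣ x → p ∣ x ^ (p ∸ 1) ∸ 1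
fermat-little′ {p@(suc n)} pp {x} p∤x with fermat-little pp x
... | t , x^p≡ with euclidsLemma x (x ^ n ∸ 1) pp (divides t (begin
  x * (x ^ n ∸ 1)      ≡⟨ *-distribˡ-∸ x (x ^ n) 1 ⟩
  x ^ p ∸ x * 1        ≡⟨ cong₂ _∸_ x^p≡ (*-identityʳ x) ⟩
  x + t * p ∸ x        ≡⟨ m+n∸m≡n x (t * p) ⟩
  t * p                ∎))
  where open ≡-Reasoning
... | inj₁ p∣x = contradiction p∣x p∤x
... | inj₂ p∣x^n∸1 = p∣x^n∸1

m*n∸1≡m∸1+m*[n∸1] : ∀ m n .{{_ : NonZero m}} .{{_ : NonZero n}} →
                    m * n ∸ 1 ≡ (m ∸ 1) + m * (n ∸ 1)
m*n∸1≡m∸1+m*[n∸1] (suc m) (suc n) = regroup m n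
  where
  regroup : ∀ m n → n + m * suc n ≡ m + suc m * n
  regroup = solve-∀

module Periods (b : ℕ) .{{_ : NonZero b}} (d : ℕ) where

  Period : ℕ → Set
  Period u = d ∣ b ^ u ∸ 1

  b^[u+v]∸1 : ∀ u v → b ^ (u + v) ∸ 1 ≡ (b ^ u ∸ 1) + b ^ u * (b ^ v ∸ 1)
  b^[u+v]∸1 u v = trans (cong (_∸ 1) (^-distribˡ-+-* b u v))
    (m*n∸1≡m∸1+m*[n∸1] (b ^ u) (b ^ v) {{m^n≢0 b u}} {{m^n≢0 b v}})

  period-0 : Period 0
  period-0 = _ ∣0

  period-+ : ∀ {u v} → Period u → Period v → Period (u + v)
  period-+ {u} {v} du dv =
    subst (d ∣_) (sym (b^[u+v]∸1 u v)) (∣m∣n⇒∣m+n du (∣n⇒∣m*n (b ^ u) dv))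

  period-∸ : ∀ {u v} → Period (u + v) → Period v → Period u
  period-∸ {u} {v} duv dv = ∣m+n∣m⇒∣n
    (subst (d ∣_) (trans (b^[u+v]∸1 u v) (+-comm (b ^ u ∸ 1) _)) duv)
    (∣n⇒∣m*n (b ^ u) dv)

  period-* : ∀ {u} → Period u → ∀ k → Period (k * u)
  period-*     du zero    = period-0
  period-* {u} du (suc k) = period-+ {u} {k * u} du (period-* du k)

  period-gcd : ∀ {u v} → Period u → Period v → Period (gcd u v)
  period-gcd {u} {v} du dv with Bézout.identity (gcd-GCD u v)
  ... | Bézout.Identity.+- x y eq =
    period-∸ {gcd u v} {y * v} (subst Period (sym eq) (period-* du x)) (period-* dv y)
  ... | Bézout.Identity.-+ x y eq =
    period-∸ {gcd u v} {x * u} (subst Period (sym eq) (period-* dv y)) (period-* du x)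

prime-factor : ∀ {n} → 1 < n → ∃ λ r → Prime r × r ∣ n
prime-factor {suc zero} (s≤s ())
prime-factor {n@(suc (suc _))} _ with factorise n
... | record { factors = r ∷ rs ; isFactorisation = n≡r*Πrs ; factorsPrime = pr ∷ _ } =
  r , pr , divides (product rs) (trans n≡r*Πrs (*-comm r _))

¬common-prime⇒coprime : ∀ {m n} .{{_ : NonZero m}} →
                        (∀ {r} → Prime r → r ∣ m → r ∣ n → ⊥) → Coprime m n
¬common-prime⇒coprime {m} _ {zero} (0∣m , _) = contradiction (0∣⇒≡0 0∣m) (≢-nonZero⁻¹ m)
¬common-prime⇒coprime _ {suc zero} _ = refl
¬common-prime⇒coprime h {d@(suc (suc _))} (d∣m , d∣n) with prime-factor {d} (s≤s (s≤s z≤n))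
... | r , pr , r∣d = ⊥-elim (h pr (∣-trans r∣d d∣m) (∣-trans r∣d d∣n))

coprime-^-divisor : ∀ {m n o} → Coprime m n → ∀ k → m ∣ n ^ k * o → m ∣ o
coprime-^-divisor {m} {o = o} _ zero m∣1*o = subst (m ∣_) (*-identityˡ o) m∣1*o
coprime-^-divisor {m} {n} {o} c (suc k) m∣n^[k+1]*o =
  coprime-^-divisor c k (coprime-divisor c (subst (m ∣_) (*-assoc n (n ^ k) o) m∣n^[k+1]*o))

[1+d]^m≡1+d*[k*d+m] : ∀ d m → ∃ λ k → suc d ^ m ≡ 1 + d * (k * d + m)
[1+d]^m≡1+d*[k*d+m] d zero = 0 , cong suc (sym (*-zeroʳ d))
[1+d]^m≡1+d*[k*d+m] d (suc m) with [1+d]^m≡1+d*[k*d+m] d m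
... | k , e = k + k * d + m , (begin
  suc d * suc d ^ m                         ≡⟨ cong (suc d *_) e ⟩
  suc d * (1 + d * (k * d + m))             ≡⟨ expand d k m ⟩
  1 + d * ((k + k * d + m) * d + suc m)     ∎)
  where
  open ≡-Reasoning
  expand : ∀ d k m → suc d * (1 + d * (k * d + m)) ≡ 1 + d * ((k + k * d + m) * d + suc m)
  expand = solve-∀

-- (1 + d) ^ m - 1 = d S with S ≡ m (mod d), so a prime dividing d and S divides m.
∣[1+d]^m∸1⇒∣d : ∀ {n d m} .{{_ : NonZero n}} →
                (∀ {r} → Prime r → r ∣ n → r ∣ d × ¬ r ∣ m) → n ∣ suc d ^ m ∸ 1 → n ∣ d
∣[1+d]^m∸1⇒∣d {n} {d} {m} good n∣ with [1+d]^m≡1+d*[k*d+m] d m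
... | k , e = coprime-divisor n⊥S (subst (n ∣_) (trans (cong (_∸ 1) e) (*-comm d _)) n∣)
  where
  n⊥S : Coprime n (k * d + m)
  n⊥S = ¬common-prime⇒coprime λ pr r∣n r∣S →
    let r∣d , r∤m = good pr r∣n in r∤m (∣m+n∣m⇒∣n r∣S (∣n⇒∣m*n k r∣d))

cofactor≡1[mod] : ∀ {m x z p} → m * (1 + x * p) ≡ 1 + z * p → ∃ λ y → m ≡ 1 + y * p
cofactor≡1[mod] {suc m} {x} {z} {p} eq = quotient p∣m , cong suc (m∣n⇒n≡quotient*m p∣m)
  where
  regroup : ∀ m x p → suc m * (1 + x * p) ≡ suc (suc m * x * p + m)
  regroup = solve-∀
  p∣m : p ∣ m
  p∣m = ∣m+n∣m⇒∣n (subst (p ∣_) (sym (suc-injective (trans (sym (regroup m x p)) eq))) (n∣m*n z))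
                   (n∣m*n (suc m * x))

module _ {a p x s : ℕ} (balance : x * x + a * p ≡ x * s * p + s) where

  x*s≡a⇒cube : x * s ≡ a → IsPerfectCube a
  x*s≡a⇒cube x*s≡a = x , (begin
    a                ≡⟨ x*s≡a ⟨
    x * s            ≡⟨ cong (x *_) x*x≡s ⟨
    x * (x * x)      ≡⟨ cong (λ q → x * (x * q)) (*-identityʳ x) ⟨
    x ^ 3            ∎)
    where
    open ≡-Reasoning
    x*x≡s : x * x ≡ s
    x*x≡s = +-cancelʳ-≡ (a * p) (x * x) s
      (trans balance (trans (cong (λ q → q * p + s) x*s≡a) (+-comm (a * p) s)))

  x*s<a⇒p<a : 1 ≤ x → x * s < a → p < a
  x*s<a⇒p<a 1≤x x*s<a with m≤n⇒∃[o]m+o≡n x*s<a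
  ... | t , x*s+1+t≡a = begin-strict
    p                    ≤⟨ m≤n*m p (suc t) ⟩
    suc t * p            ≤⟨ m≤n+m (suc t * p) (x * x) ⟩
    x * x + suc t * p    ≡⟨ s≡ ⟨
    s                    ≤⟨ m≤n*m s x {{>-nonZero 1≤x}} ⟩
    x * s                <⟨ x*s<a ⟩
    a                    ∎
    where
    open ≤-Reasoning
    regroup : ∀ x s t p → x * x + (suc (x * s) + t) * p ≡ x * s * p + (x * x + suc t * p)
    regroup = solve-∀
    s≡ : s ≡ x * x + suc t * p
    s≡ = +-cancelˡ-≡ (x * s * p) s _ (trans (sym balance)
           (trans (cong (λ q → x * x + q * p) (sym x*s+1+t≡a)) (regroup x s t p)))

  a<x*s⇒p≤x*x : a < x * s → p ≤ x * x
  a<x*s⇒p≤x*x a<x*s with m≤n⇒∃[o]m+o≡n a<x*s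
  ... | t , a+1+t≡x*s = begin
    p                    ≤⟨ m≤n*m p (suc t) ⟩
    suc t * p            ≤⟨ m≤m+n (suc t * p) s ⟩
    suc t * p + s        ≡⟨ x*x≡ ⟨
    x * x                ∎
    where
    open ≤-Reasoning
    regroup : ∀ a t p s → (suc a + t) * p + s ≡ a * p + (suc t * p + s)
    regroup = solve-∀
    x*x≡ : x * x ≡ suc t * p + s
    x*x≡ = +-cancelˡ-≡ (a * p) (x * x) _ (trans (+-comm (a * p) (x * x)) (trans balance
             (trans (cong (λ q → q * p + s) (sym a+1+t≡x*s)) (regroup a t p s))))

  cube-or-p≤4*a*a : 1 ≤ x → x * s ≤ 2 * a → IsPerfectCube a ⊎ p ≤ 4 * a * a
  cube-or-p≤4*a*a 1≤x x*s≤2a with <-cmp (x * s) a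
  ... | tri≈ _ x*s≡a _ = inj₁ (x*s≡a⇒cube x*s≡a)
  ... | tri< x*s<a _ _ = inj₂ (≤-trans (<⇒≤ (x*s<a⇒p<a 1≤x x*s<a)) (a≤4*a*a a))
    where
    a≤4*a*a : ∀ a → a ≤ 4 * a * a
    a≤4*a*a zero      = z≤n
    a≤4*a*a a@(suc _) = m≤n*m a (4 * a)
  ... | tri> _ _ a<x*s = inj₂ (begin
    p                    ≤⟨ a<x*s⇒p≤x*x a<x*s ⟩
    x * x                ≤⟨ *-mono-≤ x≤2a x≤2a ⟩
    2 * a * (2 * a)      ≡⟨ regroup a ⟩
    4 * a * a            ∎)
    where
    open ≤-Reasoning
    regroup : ∀ a → 2 * a * (2 * a) ≡ 4 * a * a
    regroup = solve-∀
    instance _ = m*n≢0⇒n≢0 x {{>-nonZero (≤-<-trans z≤n a<x*s)}}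
    x≤2a : x ≤ 2 * a
    x≤2a = ≤-trans (m≤m*n x s) x*s≤2a

module _ {a p x y : ℕ} .{{_ : NonZero p}} (eq : (1 + x * p) * (1 + y * p) ≡ a * p ^ 3 + 1) where

  private
    x+y+x*y*p≡a*p*p : x + y + x * y * p ≡ a * p * p
    x+y+x*y*p≡a*p*p = *-cancelʳ-≡ _ _ p (suc-injective (begin
      suc ((x + y + x * y * p) * p)   ≡⟨ expand x y p ⟩
      (1 + x * p) * (1 + y * p)       ≡⟨ eq ⟩
      a * p ^ 3 + 1                   ≡⟨ expand′ a p ⟩
      suc (a * p * p * p)             ∎))
      where
      open ≡-Reasoning
      expand : ∀ x y p → suc ((x + y + x * y * p) * p) ≡ (1 + x * p) * (1 + y * p)
      expand = solve-∀
      expand′ : ∀ a p → a * (p * (p * (p * 1))) + 1 ≡ suc (a * p * p * p)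
      expand′ = solve-∀

  product-normal-form : ∃ λ s → x + y ≡ s * p × x * y + s ≡ a * p
  product-normal-form = s , x+y≡s*p , *-cancelʳ-≡ _ _ p (begin
    (x * y + s) * p          ≡⟨ *-distribʳ-+ p (x * y) s ⟩
    x * y * p + s * p        ≡⟨ +-comm (x * y * p) (s * p) ⟩
    s * p + x * y * p        ≡⟨ cong (_+ x * y * p) x+y≡s*p ⟨
    x + y + x * y * p        ≡⟨ x+y+x*y*p≡a*p*p ⟩
    a * p * p                ∎)
    where
    open ≡-Reasoning
    p∣x+y : p ∣ x + y
    p∣x+y = ∣m+n∣m⇒∣n (subst (p ∣_) (trans (sym x+y+x*y*p≡a*p*p) (+-comm (x + y) _)) (n∣m*n (a * p)))
                       (n∣m*n (x * y))
    s : ℕ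
    s = quotient p∣x+y
    x+y≡s*p : x + y ≡ s * p
    x+y≡s*p = m∣n⇒n≡quotient*m p∣x+y

  diophantine : 1 ≤ x → x ≤ y → IsPerfectCube a ⊎ p ≤ 4 * a * a
  diophantine 1≤x x≤y with product-normal-form
  ... | s , x+y≡s*p , x*y+s≡a*p = cube-or-p≤4*a*a balance 1≤x x*s≤2a
    where
    balance : x * x + a * p ≡ x * s * p + s
    balance = begin
      x * x + a * p          ≡⟨ cong (x * x +_) x*y+s≡a*p ⟨
      x * x + (x * y + s)    ≡⟨ regroup x y s ⟩
      x * (x + y) + s        ≡⟨ cong (λ q → x * q + s) x+y≡s*p ⟩
      x * (s * p) + s        ≡⟨ cong (_+ s) (*-assoc x s p) ⟨
      x * s * p + s          ∎
      where
      open ≡-Reasoning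
      regroup : ∀ x y s → x * x + (x * y + s) ≡ x * (x + y) + s
      regroup = solve-∀
    x*s≤2a : x * s ≤ 2 * a
    x*s≤2a = *-cancelʳ-≤ (x * s) (2 * a) p (begin
      x * s * p                  ≡⟨ *-assoc x s p ⟩
      x * (s * p)                ≡⟨ cong (x *_) x+y≡s*p ⟨
      x * (x + y)                ≡⟨ *-distribˡ-+ x x y ⟩
      x * x + x * y              ≤⟨ +-monoˡ-≤ (x * y) (*-monoʳ-≤ x x≤y) ⟩
      x * y + x * y              ≤⟨ +-mono-≤ (m≤m+n (x * y) s) (m≤m+n (x * y) s) ⟩
      (x * y + s) + (x * y + s)  ≡⟨ cong₂ _+_ x*y+s≡a*p x*y+s≡a*p ⟩
      a * p + a * p              ≡⟨ regroup a p ⟩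
      2 * a * p                  ∎)
      where
      open ≤-Reasoning
      regroup : ∀ a p → a * p + a * p ≡ 2 * a * p
      regroup = solve-∀

module _ {a p : ℕ} (pp : Prime p) where

  private instance _ = prime⇒nonZero pp

  p∤a*p^3+1 : ¬ p ∣ a * p ^ 3 + 1
  p∤a*p^3+1 p∣n = ¬prime[1] (subst Prime (∣1⇒≡1 (∣m+n∣m⇒∣n p∣n p∣a*p^3)) pp)
    where
    p∣a*p^3 : p ∣ a * p ^ 3
    p∣a*p^3 = ∣n⇒∣m*n a (∣m⇒∣m*n (p ^ 2) ∣-refl)

  composite⇒product : Composite (a * p ^ 3 + 1) → ∀ {r} → Prime r → r ∣ a * p ^ 3 + 1 → p ∣ r ∸ 1 →
                      ∃₂ λ x y → 1 ≤ x × 1 ≤ y × (1 + x * p) * (1 + y * p) ≡ a * p ^ 3 + 1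
  composite⇒product comp {r} pr (divides e n≡e*r) (divides x r∸1≡x*p) =
    x , y , n≢0⇒n>0 x≢0 , n≢0⇒n>0 y≢0 , (begin
      (1 + x * p) * (1 + y * p)  ≡⟨ cong₂ _*_ r≡ e≡ ⟨
      r * e                      ≡⟨ *-comm r e ⟩
      e * r                      ≡⟨ n≡e*r ⟨
      a * p ^ 3 + 1              ∎)
    where
    open ≡-Reasoning
    r≡ : r ≡ 1 + x * p
    r≡ = trans (sym (suc-pred r {{prime⇒nonZero pr}})) (cong suc r∸1≡x*p)
    regroup : ∀ a p → a * (p * (p * (p * 1))) + 1 ≡ 1 + a * p * p * p
    regroup = solve-∀
    cofactor : ∃ λ y → e ≡ 1 + y * p
    cofactor = cofactor≡1[mod] {e} {x} {a * p * p} {p}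
      (trans (cong (e *_) (sym r≡)) (trans (sym n≡e*r) (regroup a p)))
    y : ℕ
    y = proj₁ cofactor
    e≡ : e ≡ 1 + y * p
    e≡ = proj₂ cofactor
    x≢0 : x ≢ 0
    x≢0 refl = ¬prime[1] (subst Prime r≡ pr)
    y≢0 : y ≢ 0
    y≢0 y≡0 = composite⇒¬prime comp (subst Prime (begin
      r                ≡⟨ *-identityˡ r ⟨
      1 * r            ≡⟨ cong (λ y → (1 + y * p) * r) y≡0 ⟨
      (1 + y * p) * r  ≡⟨ cong (_* r) e≡ ⟨
      e * r            ≡⟨ n≡e*r ⟨
      a * p ^ 3 + 1    ∎) pr)

  p∤prime-factor∸1 : ¬ IsPerfectCube a → 4 * a * a < p → Composite (a * p ^ 3 + 1) →
                     ∀ {r} → Prime r → r ∣ a * p ^ 3 + 1 → ¬ p ∣ r ∸ 1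
  p∤prime-factor∸1 noncube large comp pr r∣n p∣r∸1 with composite⇒product comp pr r∣n p∣r∸1
  ... | x , y , 1≤x , 1≤y , eq with ≤-total x y
  ...   | inj₁ x≤y = [ noncube , <⇒≱ large ]′ (diophantine eq 1≤x x≤y)
  ...   | inj₂ y≤x = [ noncube , <⇒≱ large ]′
                       (diophantine (trans (*-comm (1 + y * p) (1 + x * p)) eq) 1≤y y≤x)

  p∤prime-factor∸1⇒∣b^a∸1 : ∀ {b r} .{{_ : NonZero b}} → 1 ≤ a → Prime r →
                            r ∣ b ^ (a * p ^ 3) ∸ 1 → ¬ p ∣ r ∸ 1 → r ∣ b ^ a ∸ 1
  p∤prime-factor∸1⇒∣b^a∸1 {b} {r} 1≤a pr period-N p∤r∸1 =
    subst Period (sym (m∣n⇒n≡quotient*m g∣a)) (period-* period-g (quotient g∣a))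
    where
    open Periods b r
    N = a * p ^ 3
    instance _ = m*n≢0 a (p ^ 3) {{>-nonZero 1≤a}} {{m^n≢0 p 3}}
    r∤b : ¬ r ∣ b
    r∤b r∣b = ¬prime[1] (subst Prime (∣1⇒≡1 (∣m+n∣m⇒∣n r∣b^N period-N)) pr)
      where
      r∣b^N : r ∣ (b ^ N ∸ 1) + 1
      r∣b^N = subst (r ∣_) (trans (cong (b ^_) (suc-pred N)) (sym (m∸n+n≡m (m^n>0 b N))))
                (∣m⇒∣m*n (b ^ pred N) r∣b)
    g = gcd N (r ∸ 1)
    period-g : Period g
    period-g = period-gcd {N} {r ∸ 1} period-N (fermat-little′ pr r∤b)
    g⊥p : Coprime g p
    g⊥p (d∣g , d∣p) with prime⇒irreducible pp d∣p
    ... | inj₁ d≡1 = d≡1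
    ... | inj₂ refl = contradiction (∣-trans d∣g (gcd[m,n]∣n N (r ∸ 1))) p∤r∸1
    g∣a : g ∣ a
    g∣a = coprime-^-divisor g⊥p 3 (subst (g ∣_) (*-comm a (p ^ 3)) (gcd[m,n]∣m N (r ∸ 1)))

  ∣b^[a*p^3]∸1⇒∣b^a∸1 : ∀ {b} .{{_ : NonZero b}} → a * p ^ 3 + 1 ∣ b ^ (a * p ^ 3) ∸ 1 →
                        (∀ {r} → Prime r → r ∣ a * p ^ 3 + 1 → r ∣ b ^ a ∸ 1) →
                        a * p ^ 3 + 1 ∣ b ^ a ∸ 1
  ∣b^[a*p^3]∸1⇒∣b^a∸1 {b} n∣b^N∸1 prime-factors∣ =
    ∣[1+d]^m∸1⇒∣d {m = p ^ 3} good (subst (λ q → n ∣ q ∸ 1) b^N≡ n∣b^N∸1)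
    where
    n = a * p ^ 3 + 1
    instance _ = >-nonZero (m≤n+m 1 (a * p ^ 3))
    b^N≡ : b ^ (a * p ^ 3) ≡ suc (b ^ a ∸ 1) ^ p ^ 3
    b^N≡ = sym (trans (cong (_^ p ^ 3) (suc-pred (b ^ a) {{m^n≢0 b a}})) (^-*-assoc b a (p ^ 3)))
    good : ∀ {r} → Prime r → r ∣ n → r ∣ b ^ a ∸ 1 × ¬ r ∣ p ^ 3
    good pr r∣n = prime-factors∣ pr r∣n , λ r∣p^3 →
      [ (λ r≡1 → ¬prime[1] (subst Prime r≡1 pr)) , (λ { refl → p∤a*p^3+1 r∣n }) ]′
        (prime⇒irreducible pp (prime∣^⇒∣ pr 3 r∣p^3))

  pseudoprime⇒p≤4*a*a+b^a : ∀ {b} → 1 ≤ a → ¬ IsPerfectCube a → 1 < b →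
                            FermatPseudoprime b (a * p ^ 3 + 1) → p ≤ 4 * a * a + b ^ a
  pseudoprime⇒p≤4*a*a+b^a {b} 1≤a noncube 1<b (comp , n∣) = ≮⇒≥ λ bound<p →
    <-irrefl refl (begin-strict
      n                      ≤⟨ ∣⇒≤ (n∣b^a∸1 bound<p) ⟩
      b ^ a ∸ 1              <⟨ ≤-reflexive (suc-pred (b ^ a)) ⟩
      b ^ a                  ≤⟨ m≤n+m (b ^ a) (4 * a * a) ⟩
      4 * a * a + b ^ a      <⟨ bound<p ⟩
      p                      ≤⟨ p≤N ⟩
      a * p ^ 3              <⟨ m<m+n (a * p ^ 3) z<s ⟩
      n                      ∎)
    where
    open ≤-Reasoning
    n = a * p ^ 3 + 1
    instance
      _ = >-nonZero (<-trans z<s 1<b)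
      _ = m^n≢0 b a
      _ = >-nonZero (m<n⇒0<n∸m (<-≤-trans 1<b (subst (_≤ b ^ a) (*-identityʳ b) (^-monoʳ-≤ b 1≤a))))
    n∣b^N∸1 : n ∣ b ^ (a * p ^ 3) ∸ 1
    n∣b^N∸1 = subst (λ k → n ∣ b ^ k ∸ 1) (m+n∸n≡m (a * p ^ 3) 1) n∣
    n∣b^a∸1 : 4 * a * a + b ^ a < p → n ∣ b ^ a ∸ 1
    n∣b^a∸1 bound<p = ∣b^[a*p^3]∸1⇒∣b^a∸1 n∣b^N∸1 λ pr r∣n →
      p∤prime-factor∸1⇒∣b^a∸1 1≤a pr (∣-trans r∣n n∣b^N∸1)
        (p∤prime-factor∸1 noncube (≤-<-trans (m≤m+n (4 * a * a) (b ^ a)) bound<p) comp pr r∣n)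
    p≤N : p ≤ a * p ^ 3
    p≤N = ≤-trans (m≤m*n p (p ^ 2) {{m^n≢0 p 2}}) (m≤n*m (p ^ 3) a {{>-nonZero 1≤a}})

mainTheorem2 : (a b : ℕ) → 1 ≤ a → ¬ IsPerfectCube a → 1 < b →
    ∃ λ B → (p : ℕ) → Prime p → FermatPseudoprime b (a * p ^ 3 + 1) →
      a * p ^ 3 + 1 ≤ B
mainTheorem2 a b 1≤a noncube 1<b = a * (4 * a * a + b ^ a) ^ 3 + 1 , λ p pp pseudoprime →
  +-monoˡ-≤ 1 (*-monoʳ-≤ a (^-monoˡ-≤ 3 (pseudoprime⇒p≤4*a*a+b^a pp 1≤a noncube 1<b pseudoprime)))
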